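{- Let $r$ be a positive integer, $k\in\mathbb Z$, and $a_1,\dots,a_r$ nonzero complex numbers. Then for every integer $n\ge1$, \begin{align*} S_n^{(r,k)}(x|a_1,\dots,a_r)&=xS_{n-1}^{(r,k)}(x|a_1,\dots,a_r)+\sum_{m=1}^n\frac{(-1)^{m-1}\binom{n-1}{m-1}B_m}{m}\sum_{j=1}^r a_j^mS_{n-m}^{(r,k)}(x|a_1,\dots,a_r)\\ &\quad+\frac1nS_n^{(r+1,k-1)}(x|a_1,\dots,a_r,1)-\frac1nS_n^{(r+1,k)}(x|a_1,\dots,a_r,1), \end{align*} where $B_m$ denotes the $m$th ordinary Bernoulli number.
   Context: For an integer $k$, ${\rm Li}_k(x)=\sum_{m=1}^\infty x^m/m^k$. For $r\in\mathbb Z_{>0}$, $k\in\mathbb Z$ and nonzero complex $a_1,\dots,a_r$, the polynomials $S_n^{(r,k)}(x|a_1,\dots,a_r)$ are defined by $\frac{t^r}{\prod_{j=1}^r(e^{a_jt}-1)}\frac{{\rm Li}_k(1-e^{ -t})}{1-e^{ -t}}e^{xt}=\sum_{n\ge0}S_n^{(r,k)}(x|a_1,\dots,a_r)\frac{t^n}{n!}$; thus $S_n^{(r+1,k')}(x|a_1,\dots,a_r,1)$ is the same with $r+1$ parameters, $a_{r+1}=1$ and $k'$ in place of $k$. Ordinary Bernoulli numbers: $\frac{t}{e^t-1}=\sum_{n\ge0}B_n\frac{t^n}{n!}$. -}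

module Defs where

open import Level using (Level; _⊔_) renaming (suc to lsuc)
open import Algebra.Bundles using (CommutativeRing)
open import Data.Nat using (ℕ; zero; suc; _∸_) renaming (_+_ to _+ℕ_)
open import Data.Nat.Combinatorics using (_C_)
open import Data.Nat using (_!)
open import Data.Integer using (ℤ; +_; -[1+_])
open import Data.List using (List; []; _∷_)
open import Data.Vec using (Vec; []; _∷_)
import Data.Vec as Vec
open import Relation.Nullary using (¬_)

natF : ∀ {c ℓ} (R : CommutativeRing c ℓ) → ℕ → CommutativeRing.Carrier R
natF R zero = CommutativeRing.0# R
natF R (suc n) = CommutativeRing._+_ R (CommutativeRing.1# R) (natF R n)

-- A field of characteristic zero (e.g. ℂ).  The inverse is a total function
-- whose value at 0 is unconstrained; its defining law only holds for x ≉ 0.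
record CharZeroField c ℓ : Set (lsuc (c ⊔ ℓ)) where
  field
    commutativeRing : CommutativeRing c ℓ
  open CommutativeRing commutativeRing public
  field
    inv      : Carrier → Carrier
    inv-cong : ∀ {x y} → x ≈ y → inv x ≈ inv y
    inv-law  : ∀ x → ¬ (x ≈ 0#) → x * inv x ≈ 1#
    char0    : ∀ n → ¬ (natF commutativeRing (suc n) ≈ 0#)

module WithField {c ℓ} (F : CharZeroField c ℓ) where
  open CharZeroField F

  nat : ℕ → Carrier
  nat = natF commutativeRing

  invN : ℕ → Carrier
  invN n = inv (nat n)

  _^_ : Carrier → ℕ → Carrier
  x ^ zero = 1#
  x ^ suc n = x * (x ^ n)

  sumTo : ℕ → (ℕ → Carrier) → Carrier
  sumTo zero f = 0#
  sumTo (suc n) f = sumTo n f + f n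

  sumVec : ∀ {r} → Vec Carrier r → Carrier
  sumVec = Vec.foldr _ _+_ 0#

  -- formal power series in t, given by their coefficient sequences
  PS : Set c
  PS = ℕ → Carrier

  onePS : PS
  onePS zero = 1#
  onePS (suc n) = 0#

  mulPS : PS → PS → PS
  mulPS f g n = sumTo (suc n) (λ i → f i * g (n ∸ i))

  powPS : PS → ℕ → PS
  powPS f zero = onePS
  powPS f (suc m) = mulPS f (powPS f m)

  prodPS : ∀ {r} → Vec PS r → PS
  prodPS = Vec.foldr _ mulPS onePS

  expPS : Carrier → PS
  expPS a n = (a ^ n) * invN (n !)

  expm1PS : Carrier → PS
  expm1PS a zero = 0#
  expm1PS a (suc n) = expPS a (suc n)

  -- division by t of a series with zero constant term
  divT : PS → PS
  divT f n = f (suc n)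

  private
    nth : List Carrier → ℕ → Carrier
    nth [] _ = 0#
    nth (x ∷ xs) zero = x
    nth (x ∷ xs) (suc i) = nth xs i

    headD : List Carrier → Carrier
    headD [] = 0#
    headD (x ∷ _) = x

    -- invRev f n = [g_n , g_{n-1} , ... , g_0] where g = f⁻¹
    invRev : PS → ℕ → List Carrier
    invRev f zero = inv (f 0) ∷ []
    invRev f (suc n) =
      (- (inv (f 0) * sumTo (suc n) (λ i → f (suc i) * nth (invRev f n) i)))
      ∷ invRev f n

  invPS : PS → PS
  invPS f n = headD (invRev f n)

  tOverExpm1 : Carrier → PS
  tOverExpm1 a = invPS (divT (expm1PS a))

  B : ℕ → Carrier
  B n = nat (n !) * tOverExpm1 1# n

  -- u = 1 - e^{-t}
  uPS : PS
  uPS zero = 0#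
  uPS (suc n) = - expPS (- 1#) (suc n)

  invPowℤ : ℕ → ℤ → Carrier
  invPowℤ m (+ n) = invN m ^ n
  invPowℤ m -[1+ n ] = nat m ^ suc n

  -- Li_k(u)/u = Σ_{m ≥ 1} u^{m-1} / m^k, composed with u = 1 - e^{-t}.
  -- Since u has zero constant term, only m ≤ n+1 contribute to t^n.
  LiDivPS : ℤ → PS
  LiDivPS k n = sumTo (suc n) (λ m → invPowℤ (suc m) k * powPS uPS m n)

  genS : ∀ {r} → ℤ → Vec Carrier r → Carrier → PS
  genS k as x =
    mulPS (mulPS (prodPS (Vec.map tOverExpm1 as)) (LiDivPS k)) (expPS x)

  S : ∀ {r} → ℤ → Vec Carrier r → Carrier → ℕ → Carrier
  S k as x n = nat (n !) * genS k as x n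

{-# OPTIONS --safe #-}
module Submission where

-- Write the generating function as G = P · L_k · e^{xt}, with P = ∏ⱼ Tⱼ, Tⱼ = t/(e^{aⱼt} − 1),
-- and L_k = Li_k(u)/u, u = 1 − e^{−t}, and apply the Euler operator θ = t d/dt, a derivation
-- which multiplies the coefficient of tⁿ by n. Each factor has a simple logarithmic θ-derivative:
-- θTⱼ = Tⱼ · (1 − T₁(−aⱼt)); θe^{xt} = xt e^{xt}; and θL_k = T₁ · (L_{k−1} − L_k), because
-- θu = t e^{−t} gives θ(uᵐ) = m uᵐ T₁. Hence
--   θG = xt G + Σⱼ (1 − T₁(−aⱼt)) G + T₁ P L_{k−1} e^{xt} − T₁ P L_k e^{xt},
-- where the last two terms are the generating functions with the extra parameter 1. Comparing
-- coefficients of tⁿ, with T₁(−at) = Σₘ (−a)ᵐ Bₘ tᵐ/m!, gives the recurrence.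

open import Defs
open import Data.Nat using (ℕ; suc; _∸_; _≤_)
open import Data.Nat.Combinatorics using (_C_; nCk≡n!/k![n-k]!; k![n∸k]!∣n!)
open import Data.Nat.DivMod using (m/n*n≡m)
open import Data.Integer using (ℤ; 1ℤ) renaming (_-_ to _-ℤ_)
open import Data.Vec using (Vec; []; _∷_; _∷ʳ_)
import Data.Vec as Vec
open import Data.Vec.Relation.Unary.All using (All; []; _∷_)
open import Relation.Nullary using (¬_)
open import Algebra.Bundles using (CommutativeRing; RawRing)
open import Algebra.Solver.Ring.AlmostCommutativeRing
  using (fromCommutativeRing; _-Raw-AlmostCommutative⟶_)
import Algebra.Solver.Ring
import Algebra.Properties.Ring
import Algebra.Properties.AbelianGroup
import Relation.Binary.Reasoning.Setoid as SetoidReasoning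
import Data.Maybe as Maybe
open import Relation.Nullary.Decidable using (dec⇒maybe)
open import Data.Sum using (inj₁; inj₂)
open import Data.Product using (Σ; _,_; proj₁; proj₂)
open import Data.Nat as ℕ using (zero; _<_; z≤n; s≤s; _!)
import Data.Nat.Properties as ℕ
open import Data.Integer as ℤ using (+_; -[1+_]; _⊖_; _◃_)
import Data.Integer.Properties as ℤ
open import Data.Sign as Sign using ()
open import Relation.Binary.PropositionalEquality as ≡ using (_≡_)

module NatEmbedding {c ℓ} (R : CommutativeRing c ℓ) where
  open CommutativeRing R
  open SetoidReasoning setoid

  natF-homo-+ : ∀ m n → natF R (m ℕ.+ n) ≈ natF R m + natF R n
  natF-homo-+ zero n = sym (+-identityˡ _)
  natF-homo-+ (suc m) n = trans (+-congˡ (natF-homo-+ m n)) (sym (+-assoc _ _ _))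

  natF-homo-* : ∀ m n → natF R (m ℕ.* n) ≈ natF R m * natF R n
  natF-homo-* zero n = sym (zeroˡ _)
  natF-homo-* (suc m) n = begin
    natF R (n ℕ.+ m ℕ.* n)                  ≈⟨ natF-homo-+ n (m ℕ.* n) ⟩
    natF R n + natF R (m ℕ.* n)             ≈⟨ +-cong (sym (*-identityˡ _)) (natF-homo-* m n) ⟩
    1# * natF R n + natF R m * natF R n     ≈⟨ sym (distribʳ _ _ _) ⟩
    (1# + natF R m) * natF R n              ∎

module IntegerRingSolver {c ℓ} (R : CommutativeRing c ℓ) where
  open CommutativeRing R
  open Algebra.Properties.Ring ring using (-0#≈0#; -‿involutive; -‿distribˡ-*; -‿distribʳ-*)
  open Algebra.Properties.AbelianGroup +-abelianGroup using (⁻¹-∙-comm; xyx⁻¹≈y)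
  open NatEmbedding R
  open SetoidReasoning setoid

  private
    nat : ℕ → Carrier
    nat = natF R

  intF : ℤ → Carrier
  intF (+ n) = nat n
  intF -[1+ n ] = - nat (suc n)

  intF-homo-⊖ : ∀ m n → intF (m ⊖ n) ≈ nat m - nat n
  intF-homo-⊖ m zero = begin
    nat m         ≈⟨ sym (+-identityʳ _) ⟩
    nat m + 0#    ≈⟨ +-congˡ (sym -0#≈0#) ⟩
    nat m - 0#    ∎
  intF-homo-⊖ zero (suc n) = sym (+-identityˡ _)
  intF-homo-⊖ (suc m) (suc n) = begin
    intF (suc m ⊖ suc n)         ≡⟨ ≡.cong intF (ℤ.[1+m]⊖[1+n]≡m⊖n m n) ⟩
    intF (m ⊖ n)                 ≈⟨ intF-homo-⊖ m n ⟩
    nat m - nat n                ≈⟨ +-congʳ (sym (xyx⁻¹≈y 1# (nat m))) ⟩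
    1# + nat m - 1# - nat n      ≈⟨ +-assoc _ _ _ ⟩
    1# + nat m + (- 1# - nat n)  ≈⟨ +-congˡ (⁻¹-∙-comm 1# (nat n)) ⟩
    1# + nat m - (1# + nat n)    ∎

  intF-homo-+ : ∀ i j → intF (i ℤ.+ j) ≈ intF i + intF j
  intF-homo-+ -[1+ m ] -[1+ n ] = begin
    - (1# + nat (suc m ℕ.+ n))            ≈⟨ -‿cong (+-congˡ (natF-homo-+ (suc m) n)) ⟩
    - (1# + (nat (suc m) + nat n))        ≈⟨ -‿cong (x+[y+z]≈y+[x+z]) ⟩
    - (nat (suc m) + nat (suc n))         ≈⟨ sym (⁻¹-∙-comm _ _) ⟩
    - nat (suc m) - nat (suc n)           ∎
    where
    x+[y+z]≈y+[x+z] : 1# + (nat (suc m) + nat n) ≈ nat (suc m) + (1# + nat n)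
    x+[y+z]≈y+[x+z] = trans (sym (+-assoc _ _ _)) (trans (+-congʳ (+-comm _ _)) (+-assoc _ _ _))
  intF-homo-+ -[1+ m ] (+ n) = trans (intF-homo-⊖ n (suc m)) (+-comm _ _)
  intF-homo-+ (+ m) -[1+ n ] = intF-homo-⊖ m (suc n)
  intF-homo-+ (+ m) (+ n) = natF-homo-+ m n

  intF-homo-- : ∀ i → intF (ℤ.- i) ≈ - intF i
  intF-homo-- -[1+ n ] = sym (-‿involutive _)
  intF-homo-- (+ zero) = sym -0#≈0#
  intF-homo-- (+ suc n) = refl

  intF-+◃ : ∀ n → intF (Sign.+ ◃ n) ≈ nat n
  intF-+◃ zero = refl
  intF-+◃ (suc n) = refl

  intF--◃ : ∀ n → intF (Sign.- ◃ n) ≈ - nat n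
  intF--◃ zero = sym -0#≈0#
  intF--◃ (suc n) = refl

  intF-homo-* : ∀ i j → intF (i ℤ.* j) ≈ intF i * intF j
  intF-homo-* -[1+ m ] -[1+ n ] = begin
    intF (Sign.+ ◃ (suc m ℕ.* suc n))   ≈⟨ intF-+◃ (suc m ℕ.* suc n) ⟩
    nat (suc m ℕ.* suc n)               ≈⟨ natF-homo-* (suc m) (suc n) ⟩
    nat (suc m) * nat (suc n)           ≈⟨ sym (-‿involutive _) ⟩
    - - (nat (suc m) * nat (suc n))     ≈⟨ -‿cong (-‿distribʳ-* _ _) ⟩
    - (nat (suc m) * - nat (suc n))     ≈⟨ -‿distribˡ-* _ _ ⟩
    - nat (suc m) * - nat (suc n)       ∎
  intF-homo-* -[1+ m ] (+ n) = begin
    intF (Sign.- ◃ (suc m ℕ.* n))  ≈⟨ intF--◃ (suc m ℕ.* n) ⟩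
    - nat (suc m ℕ.* n)            ≈⟨ -‿cong (natF-homo-* (suc m) n) ⟩
    - (nat (suc m) * nat n)        ≈⟨ -‿distribˡ-* _ _ ⟩
    - nat (suc m) * nat n          ∎
  intF-homo-* (+ m) -[1+ n ] = begin
    intF (Sign.- ◃ (m ℕ.* suc n))  ≈⟨ intF--◃ (m ℕ.* suc n) ⟩
    - nat (m ℕ.* suc n)            ≈⟨ -‿cong (natF-homo-* m (suc n)) ⟩
    - (nat m * nat (suc n))        ≈⟨ -‿distribʳ-* _ _ ⟩
    nat m * - nat (suc n)          ∎
  intF-homo-* (+ m) (+ n) = trans (intF-+◃ (m ℕ.* n)) (natF-homo-* m n)

  -- A variant of intF sending + 1 to 1# on the nose, so that the solver reads the
  -- constant con (+ 1) back as 1#.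
  natR : ℕ → Carrier
  natR zero = 0#
  natR (suc zero) = 1#
  natR (suc (suc n)) = 1# + natR (suc n)

  intR : ℤ → Carrier
  intR (+ n) = natR n
  intR -[1+ n ] = - natR (suc n)

  natR≈nat : ∀ n → natR n ≈ nat n
  natR≈nat zero = refl
  natR≈nat (suc zero) = sym (+-identityʳ 1#)
  natR≈nat (suc (suc n)) = +-congˡ (natR≈nat (suc n))

  intR≈intF : ∀ i → intR i ≈ intF i
  intR≈intF (+ n) = natR≈nat n
  intR≈intF -[1+ n ] = -‿cong (natR≈nat (suc n))

  ℤ-rawRing : RawRing _ _
  ℤ-rawRing = record
    { Carrier = ℤ ; _≈_ = _≡_ ; _+_ = ℤ._+_ ; _*_ = ℤ._*_ ; -_ = ℤ.-_ ; 0# = + 0 ; 1# = + 1 }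

  intR-morphism : ℤ-rawRing -Raw-AlmostCommutative⟶ fromCommutativeRing R
  intR-morphism = record
    { ⟦_⟧ = intR
    ; +-homo = λ i j → trans (intR≈intF (i ℤ.+ j))
        (trans (intF-homo-+ i j) (sym (+-cong (intR≈intF i) (intR≈intF j))))
    ; *-homo = λ i j → trans (intR≈intF (i ℤ.* j))
        (trans (intF-homo-* i j) (sym (*-cong (intR≈intF i) (intR≈intF j))))
    ; -‿homo = λ i → trans (intR≈intF (ℤ.- i)) (trans (intF-homo-- i) (-‿cong (sym (intR≈intF i))))
    ; 0-homo = refl
    ; 1-homo = refl }

  open Algebra.Solver.Ring ℤ-rawRing (fromCommutativeRing R) intR-morphism
    (λ i j → Maybe.map (λ i≡j → reflexive (≡.cong intR i≡j)) (dec⇒maybe (i ℤ.≟ j)))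
    public

nCk*k!*[n∸k]!≡n! : ∀ {n k} → k ≤ n → (n C k) ℕ.* (k ! ℕ.* (n ∸ k) !) ≡ n !
nCk*k!*[n∸k]!≡n! {n} {k} k≤n = ≡.trans (≡.cong (ℕ._* (k ! ℕ.* (n ∸ k) !)) (nCk≡n!/k![n-k]! k≤n))
  (m/n*n≡m {{ℕ._!*_!≢0 k (n ∸ k)}} (k![n∸k]!∣n! k≤n))

module Recurrence {c ℓ} (F : CharZeroField c ℓ) where
  open CharZeroField F
  open WithField F
  open NatEmbedding commutativeRing renaming (natF-homo-+ to nat-homo-+; natF-homo-* to nat-homo-*)
  open Algebra.Properties.Ring ring using (-0#≈0#; -‿involutive; -‿anti-homo-+; -‿distribʳ-*; -1*x≈-x)
  open IntegerRingSolver commutativeRing using (solve; _:+_; _:*_; :-_; _:=_; con)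
  open SetoidReasoning setoid

  1≉0 : ¬ (1# ≈ 0#)
  1≉0 1≈0 = char0 0 (trans (+-identityʳ 1#) 1≈0)

  nat-1 : nat 1 ≈ 1#
  nat-1 = +-identityʳ 1#

  nat-!≉0 : ∀ n → ¬ (nat (n !) ≈ 0#)
  nat-!≉0 n with n ! | ℕ.1≤n! n
  ... | suc k | _ = char0 k

  *-cancelˡ : ∀ {x a b} → ¬ (x ≈ 0#) → x * a ≈ x * b → a ≈ b
  *-cancelˡ {x} {a} {b} x≉0 xa≈xb = begin
    a                ≈⟨ sym (*-identityˡ a) ⟩
    1# * a           ≈⟨ *-congʳ (trans (sym (inv-law x x≉0)) (*-comm _ _)) ⟩
    (inv x * x) * a  ≈⟨ *-assoc _ _ _ ⟩
    inv x * (x * a)  ≈⟨ *-congˡ xa≈xb ⟩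
    inv x * (x * b)  ≈⟨ sym (*-assoc _ _ _) ⟩
    (inv x * x) * b  ≈⟨ *-congʳ (trans (*-comm _ _) (inv-law x x≉0)) ⟩
    1# * b           ≈⟨ *-identityˡ b ⟩
    b                ∎

  inv-unique : ∀ {x y} → ¬ (x ≈ 0#) → x * y ≈ 1# → y ≈ inv x
  inv-unique {x} x≉0 xy≈1 = *-cancelˡ x≉0 (trans xy≈1 (sym (inv-law x x≉0)))

  inv-homo-* : ∀ {x y} → ¬ (x ≈ 0#) → ¬ (y ≈ 0#) → inv (x * y) ≈ inv x * inv y
  inv-homo-* {x} {y} x≉0 y≉0 = sym (inv-unique xy≉0 (begin
    (x * y) * (inv x * inv y)  ≈⟨ solve 4 (λ x y x′ y′ → (x :* y) :* (x′ :* y′) := (x :* x′) :* (y :* y′))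
                                     refl x y (inv x) (inv y) ⟩
    (x * inv x) * (y * inv y)  ≈⟨ *-cong (inv-law x x≉0) (inv-law y y≉0) ⟩
    1# * 1#                    ≈⟨ *-identityˡ 1# ⟩
    1#                         ∎))
    where
    xy≉0 : ¬ (x * y ≈ 0#)
    xy≉0 xy≈0 = y≉0 (*-cancelˡ x≉0 (trans xy≈0 (sym (zeroʳ x))))

  inv-1 : inv 1# ≈ 1#
  inv-1 = sym (inv-unique 1≉0 (*-identityˡ 1#))

  invN-1 : invN 1 ≈ 1#
  invN-1 = trans (inv-cong nat-1) inv-1

  nat*invN : ∀ n → nat (suc n) * invN (suc n) ≈ 1#
  nat*invN n = inv-law _ (char0 n)

  nat*invN! : ∀ n → nat (suc n) * invN (suc n !) ≈ invN (n !)
  nat*invN! n = begin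
    nat (suc n) * invN (suc n !)                ≈⟨ *-congˡ (inv-cong (nat-homo-* (suc n) (n !))) ⟩
    nat (suc n) * inv (nat (suc n) * nat (n !)) ≈⟨ *-congˡ (inv-homo-* (char0 n) (nat-!≉0 n)) ⟩
    nat (suc n) * (invN (suc n) * invN (n !))   ≈⟨ sym (*-assoc _ _ _) ⟩
    (nat (suc n) * invN (suc n)) * invN (n !)   ≈⟨ *-congʳ (nat*invN n) ⟩
    1# * invN (n !)                             ≈⟨ *-identityˡ _ ⟩
    invN (n !)                                  ∎

  invN*nat! : ∀ n → invN (suc n) * nat (suc n !) ≈ nat (n !)
  invN*nat! n = begin
    invN (suc n) * nat (suc n !)               ≈⟨ *-congˡ (nat-homo-* (suc n) (n !)) ⟩
    invN (suc n) * (nat (suc n) * nat (n !))   ≈⟨ sym (*-assoc _ _ _) ⟩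
    (invN (suc n) * nat (suc n)) * nat (n !)   ≈⟨ *-congʳ (trans (*-comm _ _) (nat*invN n)) ⟩
    1# * nat (n !)                             ≈⟨ *-identityˡ _ ⟩
    nat (n !)                                  ∎

  ^-cong : ∀ {a b} n → a ≈ b → a ^ n ≈ b ^ n
  ^-cong zero a≈b = refl
  ^-cong (suc n) a≈b = *-cong a≈b (^-cong n a≈b)

  ^-homo-+ : ∀ a m n → a ^ (m ℕ.+ n) ≈ a ^ m * a ^ n
  ^-homo-+ a zero n = sym (*-identityˡ _)
  ^-homo-+ a (suc m) n = trans (*-congˡ (^-homo-+ a m n)) (sym (*-assoc _ _ _))

  ^-distrib-* : ∀ a b n → (a * b) ^ n ≈ a ^ n * b ^ n
  ^-distrib-* a b zero = sym (*-identityˡ 1#)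
  ^-distrib-* a b (suc n) = trans (*-congˡ (^-distrib-* a b n))
    (solve 4 (λ a b x y → (a :* b) :* (x :* y) := (a :* x) :* (b :* y)) refl a b (a ^ n) (b ^ n))

  1^ : ∀ n → 1# ^ n ≈ 1#
  1^ zero = refl
  1^ (suc n) = trans (*-identityˡ _) (1^ n)

  sumTo-cong< : ∀ n {f g : ℕ → Carrier} → (∀ i → i < n → f i ≈ g i) → sumTo n f ≈ sumTo n g
  sumTo-cong< zero f≈g = refl
  sumTo-cong< (suc n) f≈g =
    +-cong (sumTo-cong< n (λ i i<n → f≈g i (ℕ.m<n⇒m<1+n i<n))) (f≈g n ℕ.≤-refl)

  sumTo-cong : ∀ n {f g : ℕ → Carrier} → (∀ i → f i ≈ g i) → sumTo n f ≈ sumTo n g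
  sumTo-cong n f≈g = sumTo-cong< n (λ i _ → f≈g i)

  sumTo-≡ : ∀ {m n} (f : ℕ → Carrier) → m ≡ n → sumTo m f ≈ sumTo n f
  sumTo-≡ f m≡n = reflexive (≡.cong (λ k → sumTo k f) m≡n)

  sumTo-+ : ∀ n (f g : ℕ → Carrier) → sumTo n (λ i → f i + g i) ≈ sumTo n f + sumTo n g
  sumTo-+ zero f g = sym (+-identityˡ 0#)
  sumTo-+ (suc n) f g = trans (+-congʳ (sumTo-+ n f g))
    (solve 4 (λ a b x y → (a :+ b) :+ (x :+ y) := (a :+ x) :+ (b :+ y)) refl
      (sumTo n f) (sumTo n g) (f n) (g n))

  sumTo-*ˡ : ∀ n a (f : ℕ → Carrier) → a * sumTo n f ≈ sumTo n (λ i → a * f i)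
  sumTo-*ˡ zero a f = zeroʳ a
  sumTo-*ˡ (suc n) a f = trans (distribˡ _ _ _) (+-congʳ (sumTo-*ˡ n a f))

  sumTo-*ʳ : ∀ n a (f : ℕ → Carrier) → sumTo n f * a ≈ sumTo n (λ i → f i * a)
  sumTo-*ʳ n a f = trans (*-comm _ _) (trans (sumTo-*ˡ n a f) (sumTo-cong n (λ i → *-comm _ _)))

  sumTo-neg : ∀ n (f : ℕ → Carrier) → - sumTo n f ≈ sumTo n (λ i → - f i)
  sumTo-neg zero f = -0#≈0#
  sumTo-neg (suc n) f = trans (trans (-‿anti-homo-+ _ _) (+-comm _ _)) (+-congʳ (sumTo-neg n f))

  sumTo-zero : ∀ n (f : ℕ → Carrier) → (∀ i → i < n → f i ≈ 0#) → sumTo n f ≈ 0#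
  sumTo-zero zero f f≈0 = refl
  sumTo-zero (suc n) f f≈0 =
    trans (+-cong (sumTo-zero n f (λ i i<n → f≈0 i (ℕ.m<n⇒m<1+n i<n))) (f≈0 n ℕ.≤-refl)) (+-identityʳ 0#)

  sumTo-head : ∀ n (f : ℕ → Carrier) → sumTo (suc n) f ≈ f 0 + sumTo n (λ i → f (suc i))
  sumTo-head zero f = trans (+-identityˡ _) (sym (+-identityʳ _))
  sumTo-head (suc n) f = trans (+-congʳ (sumTo-head n f)) (+-assoc _ _ _)

  sumTo-reverse : ∀ n (f : ℕ → Carrier) → sumTo n f ≈ sumTo n (λ i → f (n ∸ suc i))
  sumTo-reverse zero f = refl
  sumTo-reverse (suc n) f = begin
    sumTo n f + f n                      ≈⟨ +-congʳ (sumTo-reverse n f) ⟩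
    sumTo n (λ i → f (n ∸ suc i)) + f n  ≈⟨ +-comm _ _ ⟩
    f n + sumTo n (λ i → f (n ∸ suc i))  ≈⟨ sym (sumTo-head n (λ i → f (n ∸ i))) ⟩
    sumTo (suc n) (λ i → f (n ∸ i))      ∎

  sumTo-swap : ∀ m n (g : ℕ → ℕ → Carrier) →
    sumTo m (λ i → sumTo n (g i)) ≈ sumTo n (λ j → sumTo m (λ i → g i j))
  sumTo-swap zero n g = sym (sumTo-zero n _ (λ _ _ → refl))
  sumTo-swap (suc m) n g = trans (+-congʳ (sumTo-swap m n g))
    (sym (sumTo-+ n (λ j → sumTo m (λ i → g i j)) (g m)))

  sumTo-extend : ∀ m n (f : ℕ → Carrier) → m ≤ n → (∀ i → m ≤ i → i < n → f i ≈ 0#) →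
    sumTo n f ≈ sumTo m f
  sumTo-extend m zero f z≤n _ = refl
  sumTo-extend m (suc n) f m≤1+n f≈0 with ℕ.m≤n⇒m<n∨m≡n m≤1+n
  ... | inj₂ ≡.refl = refl
  ... | inj₁ (s≤s m≤n) = trans
    (+-cong (sumTo-extend m n f m≤n (λ i m≤i i<n → f≈0 i m≤i (ℕ.m<n⇒m<1+n i<n))) (f≈0 n m≤n ℕ.≤-refl))
    (+-identityʳ _)

  sumTo-triangle : ∀ n (g : ℕ → ℕ → Carrier) →
    sumTo n (λ i → sumTo (suc i) (g i)) ≈ sumTo n (λ j → sumTo (n ∸ j) (λ l → g (j ℕ.+ l) j))
  sumTo-triangle zero g = refl
  sumTo-triangle (suc n) g = begin
    sumTo n (λ i → sumTo (suc i) (g i)) + sumTo (suc n) (g n)  ≈⟨ +-congʳ (sumTo-triangle n g) ⟩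
    sumTo n column + sumTo (suc n) (g n)
      ≈⟨ +-congʳ (sym (trans (+-congˡ column-n) (+-identityʳ _))) ⟩
    sumTo (suc n) column + sumTo (suc n) (g n)                  ≈⟨ sym (sumTo-+ (suc n) column (g n)) ⟩
    sumTo (suc n) (λ j → column j + g n j)                      ≈⟨ sumTo-cong< (suc n) extend-column ⟩
    sumTo (suc n) (λ j → sumTo (suc n ∸ j) (λ l → g (j ℕ.+ l) j)) ∎
    where
    column : ℕ → Carrier
    column j = sumTo (n ∸ j) (λ l → g (j ℕ.+ l) j)
    column-n : column n ≈ 0#
    column-n = sumTo-≡ (λ l → g (n ℕ.+ l) n) (ℕ.n∸n≡0 n)
    extend-column : ∀ j → j < suc n → column j + g n j ≈ sumTo (suc n ∸ j) (λ l → g (j ℕ.+ l) j)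
    extend-column j (s≤s j≤n) = sym (trans (sumTo-≡ (λ l → g (j ℕ.+ l) j) (ℕ.+-∸-assoc 1 j≤n))
      (+-congˡ (reflexive (≡.cong (λ k → g k j) (ℕ.m+[n∸m]≡n j≤n)))))

  infix 4 _≋_
  infixl 6 _+ₚ_
  infix 8 -ₚ_

  _≋_ : PS → PS → Set ℓ
  f ≋ g = ∀ n → f n ≈ g n

  _+ₚ_ : PS → PS → PS
  (f +ₚ g) n = f n + g n

  -ₚ_ : PS → PS
  (-ₚ f) n = - f n

  0ₚ : PS
  0ₚ n = 0#

  mulPS-cong : ∀ {f f′ g g′} → f ≋ f′ → g ≋ g′ → mulPS f g ≋ mulPS f′ g′
  mulPS-cong f≋f′ g≋g′ n = sumTo-cong (suc n) (λ i → *-cong (f≋f′ i) (g≋g′ (n ∸ i)))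

  mulPS-congˡ : ∀ f {g g′} → g ≋ g′ → mulPS f g ≋ mulPS f g′
  mulPS-congˡ f g≋g′ = mulPS-cong {f} {f} (λ n → refl) g≋g′

  mulPS-congʳ : ∀ {f f′} g → f ≋ f′ → mulPS f g ≋ mulPS f′ g
  mulPS-congʳ g f≋f′ = mulPS-cong {g = g} {g} f≋f′ (λ n → refl)

  +ₚ-congˡ : ∀ f {g g′} → g ≋ g′ → f +ₚ g ≋ f +ₚ g′
  +ₚ-congˡ f g≋g′ n = +-congˡ (g≋g′ n)

  +ₚ-congʳ : ∀ {f f′} g → f ≋ f′ → f +ₚ g ≋ f′ +ₚ g
  +ₚ-congʳ g f≋f′ n = +-congʳ (f≋f′ n)

  -ₚ-cong : ∀ {f f′} → f ≋ f′ → -ₚ f ≋ -ₚ f′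
  -ₚ-cong f≋f′ n = -‿cong (f≋f′ n)

  mulPS-comm : ∀ f g → mulPS f g ≋ mulPS g f
  mulPS-comm f g n = begin
    sumTo (suc n) (λ i → f i * g (n ∸ i))              ≈⟨ sumTo-reverse (suc n) _ ⟩
    sumTo (suc n) (λ i → f (n ∸ i) * g (n ∸ (n ∸ i)))  ≈⟨ sumTo-cong< (suc n) swap ⟩
    sumTo (suc n) (λ i → g i * f (n ∸ i))              ∎
    where
    swap : ∀ i → i < suc n → f (n ∸ i) * g (n ∸ (n ∸ i)) ≈ g i * f (n ∸ i)
    swap i (s≤s i≤n) = trans (*-comm _ _) (*-congʳ (reflexive (≡.cong g (ℕ.m∸[m∸n]≡n i≤n))))

  mulPS-distribˡ : ∀ f g h → mulPS f (g +ₚ h) ≋ mulPS f g +ₚ mulPS f h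
  mulPS-distribˡ f g h n = trans (sumTo-cong (suc n) (λ i → distribˡ _ _ _)) (sumTo-+ (suc n) _ _)

  mulPS-distribʳ : ∀ f g h → mulPS (g +ₚ h) f ≋ mulPS g f +ₚ mulPS h f
  mulPS-distribʳ f g h n = trans (sumTo-cong (suc n) (λ i → distribʳ _ _ _)) (sumTo-+ (suc n) _ _)

  mulPS-identityˡ : ∀ f → mulPS onePS f ≋ f
  mulPS-identityˡ f n = begin
    sumTo (suc n) (λ i → onePS i * f (n ∸ i))              ≈⟨ sumTo-head n _ ⟩
    1# * f n + sumTo n (λ i → 0# * f (n ∸ suc i))
      ≈⟨ +-cong (*-identityˡ _) (sumTo-zero n _ (λ i _ → zeroˡ _)) ⟩
    f n + 0#                                               ≈⟨ +-identityʳ _ ⟩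
    f n                                                    ∎

  mulPS-identityʳ : ∀ f → mulPS f onePS ≋ f
  mulPS-identityʳ f n = trans (mulPS-comm f onePS n) (mulPS-identityˡ f n)

  mulPS-assoc : ∀ f g h → mulPS (mulPS f g) h ≋ mulPS f (mulPS g h)
  mulPS-assoc f g h n = begin
    sumTo (suc n) (λ i → sumTo (suc i) (λ j → f j * g (i ∸ j)) * h (n ∸ i))
      ≈⟨ sumTo-cong (suc n) (λ i → sumTo-*ʳ (suc i) _ _) ⟩
    sumTo (suc n) (λ i → sumTo (suc i) (λ j → (f j * g (i ∸ j)) * h (n ∸ i)))
      ≈⟨ sumTo-triangle (suc n) (λ i j → (f j * g (i ∸ j)) * h (n ∸ i)) ⟩
    sumTo (suc n) (λ j → sumTo (suc n ∸ j) (λ l → (f j * g ((j ℕ.+ l) ∸ j)) * h (n ∸ (j ℕ.+ l))))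
      ≈⟨ sumTo-cong< (suc n) inner ⟩
    sumTo (suc n) (λ j → f j * sumTo (suc (n ∸ j)) (λ l → g l * h ((n ∸ j) ∸ l)))
      ∎
    where
    inner : ∀ j → j < suc n →
      sumTo (suc n ∸ j) (λ l → (f j * g ((j ℕ.+ l) ∸ j)) * h (n ∸ (j ℕ.+ l)))
      ≈ f j * sumTo (suc (n ∸ j)) (λ l → g l * h ((n ∸ j) ∸ l))
    inner j (s≤s j≤n) = begin
      sumTo (suc n ∸ j) (λ l → (f j * g ((j ℕ.+ l) ∸ j)) * h (n ∸ (j ℕ.+ l)))
        ≈⟨ sumTo-≡ _ (ℕ.+-∸-assoc 1 j≤n) ⟩
      sumTo (suc (n ∸ j)) (λ l → (f j * g ((j ℕ.+ l) ∸ j)) * h (n ∸ (j ℕ.+ l)))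
        ≈⟨ sumTo-cong (suc (n ∸ j)) (λ l → trans (*-assoc _ _ _)
             (*-congˡ (*-cong (reflexive (≡.cong g (ℕ.m+n∸m≡n j l)))
                              (reflexive (≡.cong h (≡.sym (ℕ.∸-+-assoc n j l))))))) ⟩
      sumTo (suc (n ∸ j)) (λ l → f j * (g l * h ((n ∸ j) ∸ l)))
        ≈⟨ sym (sumTo-*ˡ (suc (n ∸ j)) (f j) _) ⟩
      f j * sumTo (suc (n ∸ j)) (λ l → g l * h ((n ∸ j) ∸ l))
        ∎

  PS-commutativeRing : CommutativeRing c ℓ
  PS-commutativeRing = record
    { Carrier = PS ; _≈_ = _≋_ ; _+_ = _+ₚ_ ; _*_ = mulPS ; -_ = -ₚ_ ; 0# = 0ₚ ; 1# = onePS
    ; isCommutativeRing = record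
      { isRing = record
        { +-isAbelianGroup = record
          { isGroup = record
            { isMonoid = record
              { isSemigroup = record
                { isMagma = record
                  { isEquivalence = record
                    { refl = λ n → refl ; sym = λ f≋g n → sym (f≋g n)
                    ; trans = λ f≋g g≋h n → trans (f≋g n) (g≋h n) }
                  ; ∙-cong = λ f≋f′ g≋g′ n → +-cong (f≋f′ n) (g≋g′ n) }
                ; assoc = λ f g h n → +-assoc _ _ _ }
              ; identity = (λ f n → +-identityˡ _) , (λ f n → +-identityʳ _) }
            ; inverse = (λ f n → -‿inverseˡ _) , (λ f n → -‿inverseʳ _)
            ; ⁻¹-cong = λ f≋g n → -‿cong (f≋g n) }
          ; comm = λ f g n → +-comm _ _ }
        ; *-cong = mulPS-cong
        ; *-assoc = mulPS-assoc
        ; *-identity = mulPS-identityˡ , mulPS-identityʳ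
        ; distrib = mulPS-distribˡ , mulPS-distribʳ }
      ; *-comm = mulPS-comm } }

  module PS = CommutativeRing PS-commutativeRing
    using (refl; sym; trans; +-cong)
  module ≋ = SetoidReasoning (CommutativeRing.setoid PS-commutativeRing)
  open IntegerRingSolver PS-commutativeRing using ()
    renaming (solve to solveₚ; _:+_ to _⊕_; _:*_ to _⊗_; :-_ to ⊝_; _:=_ to _≐_; con to conₚ)

  constPS : Carrier → PS
  constPS a zero = a
  constPS a (suc n) = 0#

  tPS : PS
  tPS zero = 0#
  tPS (suc zero) = 1#
  tPS (suc (suc n)) = 0#

  mulPS-constPS : ∀ a f n → mulPS (constPS a) f n ≈ a * f n
  mulPS-constPS a f n = begin
    sumTo (suc n) (λ i → constPS a i * f (n ∸ i))  ≈⟨ sumTo-head n _ ⟩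
    a * f n + sumTo n (λ i → 0# * f (n ∸ suc i))   ≈⟨ +-congˡ (sumTo-zero n _ (λ i _ → zeroˡ _)) ⟩
    a * f n + 0#                                   ≈⟨ +-identityʳ _ ⟩
    a * f n                                        ∎

  constPS-homo-+ : ∀ a b → constPS a +ₚ constPS b ≋ constPS (a + b)
  constPS-homo-+ a b zero = refl
  constPS-homo-+ a b (suc n) = +-identityʳ _

  constPS-cong : ∀ {a b} → a ≈ b → constPS a ≋ constPS b
  constPS-cong a≈b zero = a≈b
  constPS-cong a≈b (suc n) = refl

  constPS-neg : ∀ a → -ₚ constPS a ≋ constPS (- a)
  constPS-neg a zero = refl
  constPS-neg a (suc n) = -0#≈0#

  constPS-1 : constPS 1# ≋ onePS
  constPS-1 zero = refl
  constPS-1 (suc n) = refl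

  mulPS-tPS-zero : ∀ f → mulPS tPS f 0 ≈ 0#
  mulPS-tPS-zero f = trans (+-identityˡ _) (zeroˡ _)

  mulPS-tPS-suc : ∀ f n → mulPS tPS f (suc n) ≈ f n
  mulPS-tPS-suc f n = begin
    sumTo (suc (suc n)) (λ i → tPS i * f (suc n ∸ i))
      ≈⟨ trans (sumTo-head (suc n) _) (trans (+-congʳ (zeroˡ _)) (+-identityˡ _)) ⟩
    sumTo (suc n) (λ i → tPS (suc i) * f (n ∸ i))
      ≈⟨ sumTo-head n _ ⟩
    1# * f n + sumTo n (λ i → 0# * f (n ∸ suc i))
      ≈⟨ +-cong (*-identityˡ _) (sumTo-zero n _ (λ i _ → zeroˡ _)) ⟩
    f n + 0#
      ≈⟨ +-identityʳ _ ⟩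
    f n ∎

  mulPS-tPS-cancel : ∀ {f g} → mulPS tPS f ≋ mulPS tPS g → f ≋ g
  mulPS-tPS-cancel {f} {g} tf≋tg n =
    trans (sym (mulPS-tPS-suc f n)) (trans (tf≋tg (suc n)) (mulPS-tPS-suc g n))

  -- The Euler operator θ = t d/dt

  θ : PS → PS
  θ f n = nat n * f n

  θ-cong : ∀ {f g} → f ≋ g → θ f ≋ θ g
  θ-cong f≋g n = *-congˡ (f≋g n)

  θ-homo-+ : ∀ f g → θ (f +ₚ g) ≋ θ f +ₚ θ g
  θ-homo-+ f g n = distribˡ _ _ _

  θ-homo-- : ∀ f → θ (-ₚ f) ≋ -ₚ θ f
  θ-homo-- f n = sym (-‿distribʳ-* _ _)

  θ-onePS : θ onePS ≋ 0ₚ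
  θ-onePS zero = zeroˡ _
  θ-onePS (suc n) = zeroʳ _

  θ-tPS : θ tPS ≋ tPS
  θ-tPS zero = zeroˡ _
  θ-tPS (suc zero) = trans (*-identityʳ _) nat-1
  θ-tPS (suc (suc n)) = zeroʳ _

  θ-leibniz : ∀ f g → θ (mulPS f g) ≋ mulPS (θ f) g +ₚ mulPS f (θ g)
  θ-leibniz f g n = begin
    nat n * sumTo (suc n) (λ i → f i * g (n ∸ i))
      ≈⟨ sumTo-*ˡ (suc n) _ _ ⟩
    sumTo (suc n) (λ i → nat n * (f i * g (n ∸ i)))
      ≈⟨ sumTo-cong< (suc n) split ⟩
    sumTo (suc n) (λ i → (nat i * f i) * g (n ∸ i) + f i * (nat (n ∸ i) * g (n ∸ i)))
      ≈⟨ sumTo-+ (suc n) _ _ ⟩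
    mulPS (θ f) g n + mulPS f (θ g) n
      ∎
    where
    split : ∀ i → i < suc n →
      nat n * (f i * g (n ∸ i)) ≈ (nat i * f i) * g (n ∸ i) + f i * (nat (n ∸ i) * g (n ∸ i))
    split i (s≤s i≤n) = begin
      nat n * (f i * g (n ∸ i))
        ≈⟨ *-congʳ (trans (reflexive (≡.cong nat (≡.sym (ℕ.m+[n∸m]≡n i≤n)))) (nat-homo-+ i (n ∸ i))) ⟩
      (nat i + nat (n ∸ i)) * (f i * g (n ∸ i))
        ≈⟨ solve 4 (λ a b x y → (a :+ b) :* (x :* y) := (a :* x) :* y :+ x :* (b :* y)) refl
             (nat i) (nat (n ∸ i)) (f i) (g (n ∸ i)) ⟩
      (nat i * f i) * g (n ∸ i) + f i * (nat (n ∸ i) * g (n ∸ i))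
        ∎

  θ-unique : ∀ a {f g} → θ f ≋ mulPS (constPS a) (mulPS tPS f) → θ g ≋ mulPS (constPS a) (mulPS tPS g) →
    f 0 ≈ g 0 → f ≋ g
  θ-unique a θf θg f0≈g0 zero = f0≈g0
  θ-unique a {f} {g} θf θg f0≈g0 (suc n) = *-cancelˡ (char0 n) (begin
    nat (suc n) * f (suc n)  ≈⟨ θf (suc n) ⟩
    mulPS (constPS a) (mulPS tPS f) (suc n)
      ≈⟨ trans (mulPS-constPS a (mulPS tPS f) (suc n)) (*-congˡ (mulPS-tPS-suc f n)) ⟩
    a * f n                  ≈⟨ *-congˡ (θ-unique a θf θg f0≈g0 n) ⟩
    a * g n
      ≈⟨ sym (trans (mulPS-constPS a (mulPS tPS g) (suc n)) (*-congˡ (mulPS-tPS-suc g n))) ⟩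
    mulPS (constPS a) (mulPS tPS g) (suc n) ≈⟨ sym (θg (suc n)) ⟩
    nat (suc n) * g (suc n)  ∎)

  expPS-zero : ∀ a → expPS a 0 ≈ 1#
  expPS-zero a = trans (*-identityˡ _) invN-1

  θ-expPS : ∀ a → θ (expPS a) ≋ mulPS (constPS a) (mulPS tPS (expPS a))
  θ-expPS a zero = trans (zeroˡ _)
    (sym (trans (mulPS-constPS a (mulPS tPS (expPS a)) 0)
      (trans (*-congˡ (mulPS-tPS-zero (expPS a))) (zeroʳ a))))
  θ-expPS a (suc m) = begin
    nat (suc m) * ((a * a ^ m) * invN (suc m !))
      ≈⟨ solve 4 (λ n a p i → n :* ((a :* p) :* i) := a :* (p :* (n :* i))) refl
           (nat (suc m)) a (a ^ m) (invN (suc m !)) ⟩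
    a * (a ^ m * (nat (suc m) * invN (suc m !)))  ≈⟨ *-congˡ (*-congˡ (nat*invN! m)) ⟩
    a * expPS a m                                 ≈⟨ *-congˡ (sym (mulPS-tPS-suc (expPS a) m)) ⟩
    a * mulPS tPS (expPS a) (suc m)               ≈⟨ sym (mulPS-constPS a (mulPS tPS (expPS a)) (suc m)) ⟩
    mulPS (constPS a) (mulPS tPS (expPS a)) (suc m) ∎

  expPS-inverse : ∀ a → mulPS (expPS a) (expPS (- a)) ≋ onePS
  expPS-inverse a = θ-unique 0# θ-product θ-one (begin
    0# + expPS a 0 * expPS (- a) 0  ≈⟨ +-identityˡ _ ⟩
    expPS a 0 * expPS (- a) 0       ≈⟨ *-cong (expPS-zero a) (expPS-zero (- a)) ⟩
    1# * 1#                         ≈⟨ *-identityˡ 1# ⟩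
    1#                              ∎)
    where
    e = expPS a
    e′ = expPS (- a)
    constPS-0 : ∀ f → mulPS (constPS 0#) f ≋ 0ₚ
    constPS-0 f n = trans (mulPS-constPS 0# f n) (zeroˡ _)
    θ-product : θ (mulPS e e′) ≋ mulPS (constPS 0#) (mulPS tPS (mulPS e e′))
    θ-product = ≋.begin
      θ (mulPS e e′)
        ≋.≈⟨ θ-leibniz e e′ ⟩
      mulPS (θ e) e′ +ₚ mulPS e (θ e′)
        ≋.≈⟨ PS.+-cong (mulPS-congʳ e′ (θ-expPS a)) (mulPS-congˡ e (θ-expPS (- a))) ⟩
      mulPS (mulPS (constPS a) (mulPS tPS e)) e′ +ₚ mulPS e (mulPS (constPS (- a)) (mulPS tPS e′))
        ≋.≈⟨ solveₚ 5 (λ A A′ t e e′ → (A ⊗ (t ⊗ e)) ⊗ e′ ⊕ e ⊗ (A′ ⊗ (t ⊗ e′)) ≐ (A ⊕ A′) ⊗ (t ⊗ (e ⊗ e′)))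
             PS.refl (constPS a) (constPS (- a)) tPS e e′ ⟩
      mulPS (constPS a +ₚ constPS (- a)) (mulPS tPS (mulPS e e′))
        ≋.≈⟨ mulPS-congʳ (mulPS tPS (mulPS e e′))
               (PS.trans (constPS-homo-+ a (- a)) (constPS-cong (-‿inverseʳ a))) ⟩
      mulPS (constPS 0#) (mulPS tPS (mulPS e e′))
        ≋.∎
    θ-one : θ onePS ≋ mulPS (constPS 0#) (mulPS tPS onePS)
    θ-one = PS.trans θ-onePS (PS.sym (constPS-0 (mulPS tPS onePS)))

  -- Defs computes invPS through private helpers; the first projection below names, by
  -- its normal form, the list of earlier coefficients that the recursion reads.
  private
    invPS-unfold : ∀ f n → Σ (ℕ → Carrier) (λ h →
      invPS f (suc n) ≡ - (inv (f 0) * sumTo (suc n) (λ i → f (suc i) * h i)))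
    invPS-unfold f n = _ , ≡.refl

    invPS-earlier : ∀ f n i → i ≤ n → proj₁ (invPS-unfold f n) i ≈ invPS f (n ∸ i)
    invPS-earlier f zero zero z≤n = refl
    invPS-earlier f (suc n) zero z≤n = refl
    invPS-earlier f (suc n) (suc i) (s≤s i≤n) = invPS-earlier f n i i≤n

  invPS-suc : ∀ f n →
    invPS f (suc n) ≈ - (inv (f 0) * sumTo (suc n) (λ i → f (suc i) * invPS f (n ∸ i)))
  invPS-suc f n = trans (reflexive (proj₂ (invPS-unfold f n)))
    (-‿cong (*-congˡ (sumTo-cong< (suc n) (λ i i≤n → *-congˡ (invPS-earlier f n i (ℕ.≤-pred i≤n))))))

  mulPS-invPS : ∀ f → ¬ (f 0 ≈ 0#) → mulPS f (invPS f) ≋ onePS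
  mulPS-invPS f f0≉0 zero = trans (+-identityˡ _) (inv-law _ f0≉0)
  mulPS-invPS f f0≉0 (suc n) = begin
    mulPS f (invPS f) (suc n)        ≈⟨ sumTo-head (suc n) _ ⟩
    f 0 * invPS f (suc n) + s        ≈⟨ +-congʳ (*-congˡ (invPS-suc f n)) ⟩
    f 0 * - (inv (f 0) * s) + s      ≈⟨ solve 3 (λ a i s → a :* (:- (i :* s)) :+ s := :- ((a :* i) :* s) :+ s)
                                          refl (f 0) (inv (f 0)) s ⟩
    - ((f 0 * inv (f 0)) * s) + s    ≈⟨ +-congʳ (-‿cong (*-congʳ (inv-law _ f0≉0))) ⟩
    - (1# * s) + s                   ≈⟨ solve 1 (λ s → :- (con (+ 1) :* s) :+ s := con (+ 0)) refl s ⟩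
    0#                               ∎
    where
    s = sumTo (suc n) (λ i → f (suc i) * invPS f (n ∸ i))

  expm1DivT : Carrier → PS
  expm1DivT a = divT (expm1PS a)

  expm1DivT-zero : ∀ a → expm1DivT a 0 ≈ a
  expm1DivT-zero a = trans (*-cong (*-identityʳ a) invN-1) (*-identityʳ a)

  expm1DivT-tOverExpm1 : ∀ a → ¬ (a ≈ 0#) → mulPS (expm1DivT a) (tOverExpm1 a) ≋ onePS
  expm1DivT-tOverExpm1 a a≉0 = mulPS-invPS (expm1DivT a) (λ e → a≉0 (trans (sym (expm1DivT-zero a)) e))

  tPS-expm1DivT : ∀ a → mulPS tPS (expm1DivT a) ≋ expPS a +ₚ -ₚ onePS
  tPS-expm1DivT a zero =
    trans (mulPS-tPS-zero (expm1DivT a)) (sym (trans (+-congʳ (expPS-zero a)) (-‿inverseʳ 1#)))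
  tPS-expm1DivT a (suc n) =
    trans (mulPS-tPS-suc (expm1DivT a) n) (sym (trans (+-congˡ -0#≈0#) (+-identityʳ _)))

  θ-expm1DivT : ∀ a → θ (expm1DivT a) ≋ mulPS (constPS a) (expPS a) +ₚ -ₚ expm1DivT a
  θ-expm1DivT a = mulPS-tPS-cancel (≋.begin
    mulPS tPS (θ E)
      ≋.≈⟨ solveₚ 3 (λ tE t θE → t ⊗ θE ≐ (tE ⊕ t ⊗ θE) ⊕ ⊝ tE) PS.refl (mulPS tPS E) tPS (θ E) ⟩
    (mulPS tPS E +ₚ mulPS tPS (θ E)) +ₚ -ₚ mulPS tPS E
      ≋.≈⟨ +ₚ-congʳ (-ₚ mulPS tPS E) (PS.sym (PS.trans (θ-leibniz tPS E)
             (+ₚ-congʳ (mulPS tPS (θ E)) (mulPS-congʳ E θ-tPS)))) ⟩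
    θ (mulPS tPS E) +ₚ -ₚ mulPS tPS E
      ≋.≈⟨ +ₚ-congʳ (-ₚ mulPS tPS E) (θ-cong (tPS-expm1DivT a)) ⟩
    θ (e +ₚ -ₚ onePS) +ₚ -ₚ mulPS tPS E
      ≋.≈⟨ +ₚ-congʳ (-ₚ mulPS tPS E) (PS.trans (θ-homo-+ e (-ₚ onePS))
             (λ n → +-cong (θ-expPS a n) (trans (θ-homo-- onePS n) (trans (-‿cong (θ-onePS n)) -0#≈0#)))) ⟩
    (mulPS (constPS a) (mulPS tPS e) +ₚ 0ₚ) +ₚ -ₚ mulPS tPS E
      ≋.≈⟨ solveₚ 4 (λ A t e E → (A ⊗ (t ⊗ e) ⊕ conₚ (+ 0)) ⊕ ⊝ (t ⊗ E) ≐ t ⊗ (A ⊗ e ⊕ ⊝ E))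
             PS.refl (constPS a) tPS e E ⟩
    mulPS tPS (mulPS (constPS a) e +ₚ -ₚ E)
      ≋.∎)
    where
    E = expm1DivT a
    e = expPS a

  θ-tOverExpm1′ : ∀ a → ¬ (a ≈ 0#) →
    θ (tOverExpm1 a) ≋ mulPS (tOverExpm1 a) (onePS +ₚ -ₚ mulPS (constPS a) (mulPS (tOverExpm1 a) (expPS a)))
  θ-tOverExpm1′ a a≉0 = ≋.begin
    θ T
      ≋.≈⟨ PS.sym (mulPS-identityˡ (θ T)) ⟩
    mulPS onePS (θ T)
      ≋.≈⟨ mulPS-congʳ (θ T) (PS.sym ET≋1) ⟩
    mulPS (mulPS E T) (θ T)
      ≋.≈⟨ solveₚ 4 (λ T E θT θE → (E ⊗ T) ⊗ θT ≐ T ⊗ ((θE ⊗ T ⊕ E ⊗ θT) ⊕ ⊝ (θE ⊗ T)))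
             PS.refl T E (θ T) (θ E) ⟩
    mulPS T ((mulPS (θ E) T +ₚ mulPS E (θ T)) +ₚ -ₚ mulPS (θ E) T)
      ≋.≈⟨ mulPS-congˡ T (+ₚ-congʳ (-ₚ mulPS (θ E) T) θ[ET]≋0) ⟩
    mulPS T (0ₚ +ₚ -ₚ mulPS (θ E) T)
      ≋.≈⟨ mulPS-congˡ T (+ₚ-congˡ 0ₚ (-ₚ-cong (mulPS-congʳ T (θ-expm1DivT a)))) ⟩
    mulPS T (0ₚ +ₚ -ₚ mulPS (mulPS (constPS a) e +ₚ -ₚ E) T)
      ≋.≈⟨ solveₚ 4 (λ T E A e → T ⊗ (conₚ (+ 0) ⊕ ⊝ ((A ⊗ e ⊕ ⊝ E) ⊗ T)) ≐ T ⊗ (E ⊗ T ⊕ ⊝ (A ⊗ (T ⊗ e))))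
             PS.refl T E (constPS a) e ⟩
    mulPS T (mulPS E T +ₚ -ₚ mulPS (constPS a) (mulPS T e))
      ≋.≈⟨ mulPS-congˡ T (+ₚ-congʳ (-ₚ mulPS (constPS a) (mulPS T e)) ET≋1) ⟩
    mulPS T (onePS +ₚ -ₚ mulPS (constPS a) (mulPS T e))
      ≋.∎
    where
    T = tOverExpm1 a
    E = expm1DivT a
    e = expPS a
    ET≋1 : mulPS E T ≋ onePS
    ET≋1 = expm1DivT-tOverExpm1 a a≉0
    θ[ET]≋0 : mulPS (θ E) T +ₚ mulPS E (θ T) ≋ 0ₚ
    θ[ET]≋0 = PS.trans (PS.sym (θ-leibniz E T)) (PS.trans (θ-cong ET≋1) θ-onePS)

  scale : Carrier → PS → PS
  scale c f n = c ^ n * f n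

  scale-cong : ∀ c {f g} → f ≋ g → scale c f ≋ scale c g
  scale-cong c f≋g n = *-congˡ (f≋g n)

  scale-onePS : ∀ c → scale c onePS ≋ onePS
  scale-onePS c zero = *-identityˡ _
  scale-onePS c (suc n) = zeroʳ _

  scale-mulPS : ∀ c f g → scale c (mulPS f g) ≋ mulPS (scale c f) (scale c g)
  scale-mulPS c f g n = trans (sumTo-*ˡ (suc n) _ _) (sumTo-cong< (suc n) split)
    where
    split : ∀ i → i < suc n → c ^ n * (f i * g (n ∸ i)) ≈ (c ^ i * f i) * (c ^ (n ∸ i) * g (n ∸ i))
    split i (s≤s i≤n) = trans
      (*-congʳ (trans (reflexive (≡.cong (c ^_) (≡.sym (ℕ.m+[n∸m]≡n i≤n)))) (^-homo-+ c i (n ∸ i))))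
      (solve 4 (λ p q x y → (p :* q) :* (x :* y) := (p :* x) :* (q :* y)) refl
        (c ^ i) (c ^ (n ∸ i)) (f i) (g (n ∸ i)))

  T₁ : PS
  T₁ = tOverExpm1 1#

  E₁ : PS
  E₁ = expm1DivT 1#

  E₁-T₁ : mulPS E₁ T₁ ≋ onePS
  E₁-T₁ = expm1DivT-tOverExpm1 1# 1≉0

  expm1DivT-scale : ∀ a → expm1DivT a ≋ mulPS (constPS a) (scale a E₁)
  expm1DivT-scale a m = sym (trans (mulPS-constPS a (scale a E₁) m)
    (trans (*-congˡ (*-congˡ (*-congʳ (trans (*-identityˡ _) (1^ m)))))
      (solve 3 (λ b p i → b :* (p :* (con (+ 1) :* i)) := (b :* p) :* i) refl a (a ^ m) (invN (suc m !)))))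

  scaleT₁-expm1DivT-neg : ∀ a → mulPS (scale (- a) T₁) (expm1DivT (- a)) ≋ constPS (- a)
  scaleT₁-expm1DivT-neg a = ≋.begin
    mulPS H (expm1DivT (- a))              ≋.≈⟨ mulPS-congˡ H (expm1DivT-scale (- a)) ⟩
    mulPS H (mulPS A (scale (- a) E₁))
      ≋.≈⟨ solveₚ 3 (λ h c s → h ⊗ (c ⊗ s) ≐ c ⊗ (s ⊗ h)) PS.refl H A (scale (- a) E₁) ⟩
    mulPS A (mulPS (scale (- a) E₁) H)     ≋.≈⟨ mulPS-congˡ A (PS.sym (scale-mulPS (- a) E₁ T₁)) ⟩
    mulPS A (scale (- a) (mulPS E₁ T₁))
      ≋.≈⟨ mulPS-congˡ A (PS.trans (scale-cong (- a) E₁-T₁) (scale-onePS (- a))) ⟩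
    mulPS A onePS                          ≋.≈⟨ mulPS-identityʳ A ⟩
    A                                      ≋.∎
    where
    H = scale (- a) T₁
    A = constPS (- a)

  expm1DivT-neg-expPS : ∀ a → mulPS (expm1DivT (- a)) (expPS a) ≋ -ₚ expm1DivT a
  expm1DivT-neg-expPS a = mulPS-tPS-cancel (≋.begin
    mulPS tPS (mulPS E′ e)              ≋.≈⟨ PS.sym (mulPS-assoc tPS E′ e) ⟩
    mulPS (mulPS tPS E′) e              ≋.≈⟨ mulPS-congʳ e (tPS-expm1DivT (- a)) ⟩
    mulPS (e′ +ₚ -ₚ onePS) e
      ≋.≈⟨ solveₚ 2 (λ e e′ → (e′ ⊕ ⊝ conₚ (+ 1)) ⊗ e ≐ (e ⊗ e′ ⊕ ⊝ conₚ (+ 1)) ⊕ ⊝ (e ⊕ ⊝ conₚ (+ 1)))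
             PS.refl e e′ ⟩
    (mulPS e e′ +ₚ -ₚ onePS) +ₚ -ₚ (e +ₚ -ₚ onePS)
      ≋.≈⟨ +ₚ-congʳ (-ₚ (e +ₚ -ₚ onePS)) (+ₚ-congʳ (-ₚ onePS) (expPS-inverse a)) ⟩
    (onePS +ₚ -ₚ onePS) +ₚ -ₚ (e +ₚ -ₚ onePS)
      ≋.≈⟨ +ₚ-congˡ (onePS +ₚ -ₚ onePS) (-ₚ-cong (PS.sym (tPS-expm1DivT a))) ⟩
    (onePS +ₚ -ₚ onePS) +ₚ -ₚ mulPS tPS (expm1DivT a)
      ≋.≈⟨ solveₚ 2 (λ t E → (conₚ (+ 1) ⊕ ⊝ conₚ (+ 1)) ⊕ ⊝ (t ⊗ E) ≐ t ⊗ (⊝ E)) PS.refl tPS (expm1DivT a) ⟩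
    mulPS tPS (-ₚ expm1DivT a)          ≋.∎)
    where
    E′ = expm1DivT (- a)
    e = expPS a
    e′ = expPS (- a)

  scaleT₁-expm1DivT : ∀ a → mulPS (scale (- a) T₁) (expm1DivT a) ≋ mulPS (constPS a) (expPS a)
  scaleT₁-expm1DivT a = ≋.begin
    mulPS H (expm1DivT a)
      ≋.≈⟨ mulPS-congˡ H (PS.trans (λ n → sym (-‿involutive _)) (-ₚ-cong (PS.sym (expm1DivT-neg-expPS a)))) ⟩
    mulPS H (-ₚ mulPS (expm1DivT (- a)) e)
      ≋.≈⟨ solveₚ 3 (λ h E e → h ⊗ (⊝ (E ⊗ e)) ≐ (⊝ (h ⊗ E)) ⊗ e) PS.refl H (expm1DivT (- a)) e ⟩
    mulPS (-ₚ mulPS H (expm1DivT (- a))) e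
      ≋.≈⟨ mulPS-congʳ e (PS.trans (-ₚ-cong (scaleT₁-expm1DivT-neg a))
             (PS.trans (constPS-neg (- a)) (constPS-cong (-‿involutive a)))) ⟩
    mulPS (constPS a) e
      ≋.∎
    where
    H = scale (- a) T₁
    e = expPS a

  constPS-tOverExpm1-expPS : ∀ a → ¬ (a ≈ 0#) →
    mulPS (constPS a) (mulPS (tOverExpm1 a) (expPS a)) ≋ scale (- a) T₁
  constPS-tOverExpm1-expPS a a≉0 = PS.sym (≋.begin
    H                              ≋.≈⟨ PS.sym (mulPS-identityʳ H) ⟩
    mulPS H onePS                  ≋.≈⟨ mulPS-congˡ H (PS.sym (expm1DivT-tOverExpm1 a a≉0)) ⟩
    mulPS H (mulPS (expm1DivT a) T) ≋.≈⟨ PS.sym (mulPS-assoc H (expm1DivT a) T) ⟩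
    mulPS (mulPS H (expm1DivT a)) T ≋.≈⟨ mulPS-congʳ T (scaleT₁-expm1DivT a) ⟩
    mulPS (mulPS (constPS a) e) T  ≋.≈⟨ solveₚ 3 (λ A e T → (A ⊗ e) ⊗ T ≐ A ⊗ (T ⊗ e)) PS.refl (constPS a) e T ⟩
    mulPS (constPS a) (mulPS T e)  ≋.∎)
    where
    H = scale (- a) T₁
    T = tOverExpm1 a
    e = expPS a

  θ-tOverExpm1 : ∀ a → ¬ (a ≈ 0#) → θ (tOverExpm1 a) ≋ mulPS (tOverExpm1 a) (onePS +ₚ -ₚ scale (- a) T₁)
  θ-tOverExpm1 a a≉0 = PS.trans (θ-tOverExpm1′ a a≉0)
    (mulPS-congˡ (tOverExpm1 a) (+ₚ-congˡ onePS (-ₚ-cong (constPS-tOverExpm1-expPS a a≉0))))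

  -- Li_k(u)/u with u = 1 − e^{−t}

  uPS-def : uPS ≋ onePS +ₚ -ₚ expPS (- 1#)
  uPS-def zero = sym (trans (+-congˡ (-‿cong (expPS-zero (- 1#)))) (-‿inverseʳ 1#))
  uPS-def (suc n) = sym (+-identityˡ _)

  θ-uPS : θ uPS ≋ mulPS tPS (expPS (- 1#))
  θ-uPS = ≋.begin
    θ uPS                                      ≋.≈⟨ θ-cong uPS-def ⟩
    θ (onePS +ₚ -ₚ e⁻)                         ≋.≈⟨ θ-homo-+ onePS (-ₚ e⁻) ⟩
    θ onePS +ₚ θ (-ₚ e⁻)                       ≋.≈⟨ (λ n → +-cong (θ-onePS n) (θ-homo-- e⁻ n)) ⟩
    0ₚ +ₚ -ₚ θ e⁻                              ≋.≈⟨ +ₚ-congˡ 0ₚ (-ₚ-cong (θ-expPS (- 1#))) ⟩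
    0ₚ +ₚ -ₚ mulPS (constPS (- 1#)) (mulPS tPS e⁻)
      ≋.≈⟨ solveₚ 2 (λ c f → conₚ (+ 0) ⊕ ⊝ (c ⊗ f) ≐ (⊝ c) ⊗ f) PS.refl (constPS (- 1#)) (mulPS tPS e⁻) ⟩
    mulPS (-ₚ constPS (- 1#)) (mulPS tPS e⁻)
      ≋.≈⟨ mulPS-congʳ (mulPS tPS e⁻) (PS.trans (constPS-neg (- 1#)) (constPS-cong (-‿involutive 1#))) ⟩
    mulPS (constPS 1#) (mulPS tPS e⁻)
      ≋.≈⟨ PS.trans (mulPS-congʳ (mulPS tPS e⁻) constPS-1) (mulPS-identityˡ _) ⟩
    mulPS tPS e⁻                               ≋.∎
    where
    e⁻ = expPS (- 1#)

  θ-uPS-E₁ : mulPS (θ uPS) E₁ ≋ uPS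
  θ-uPS-E₁ = ≋.begin
    mulPS (θ uPS) E₁                 ≋.≈⟨ mulPS-congʳ E₁ θ-uPS ⟩
    mulPS (mulPS tPS e⁻) E₁          ≋.≈⟨ solveₚ 3 (λ t e E → (t ⊗ e) ⊗ E ≐ e ⊗ (t ⊗ E)) PS.refl tPS e⁻ E₁ ⟩
    mulPS e⁻ (mulPS tPS E₁)          ≋.≈⟨ mulPS-congˡ e⁻ (tPS-expm1DivT 1#) ⟩
    mulPS e⁻ (e +ₚ -ₚ onePS)
      ≋.≈⟨ solveₚ 2 (λ e⁻ e → e⁻ ⊗ (e ⊕ ⊝ conₚ (+ 1)) ≐ e ⊗ e⁻ ⊕ ⊝ e⁻) PS.refl e⁻ e ⟩
    mulPS e e⁻ +ₚ -ₚ e⁻              ≋.≈⟨ +ₚ-congʳ (-ₚ e⁻) (expPS-inverse 1#) ⟩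
    onePS +ₚ -ₚ e⁻                   ≋.≈⟨ PS.sym uPS-def ⟩
    uPS                              ≋.∎
    where
    e = expPS 1#
    e⁻ = expPS (- 1#)

  constPS-nat-suc : ∀ m → constPS (nat (suc m)) ≋ onePS +ₚ constPS (nat m)
  constPS-nat-suc m zero = refl
  constPS-nat-suc m (suc n) = sym (+-identityˡ _)

  θ-powPS : ∀ f m → θ (powPS f (suc m)) ≋ mulPS (constPS (nat (suc m))) (mulPS (powPS f m) (θ f))
  θ-powPS f zero = ≋.begin
    θ (mulPS f onePS)                           ≋.≈⟨ θ-leibniz f onePS ⟩
    mulPS (θ f) onePS +ₚ mulPS f (θ onePS)      ≋.≈⟨ +ₚ-congˡ (mulPS (θ f) onePS) (mulPS-congˡ f θ-onePS) ⟩
    mulPS (θ f) onePS +ₚ mulPS f 0ₚ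
      ≋.≈⟨ solveₚ 2 (λ θf f → θf ⊗ conₚ (+ 1) ⊕ f ⊗ conₚ (+ 0) ≐ conₚ (+ 1) ⊗ (conₚ (+ 1) ⊗ θf))
             PS.refl (θ f) f ⟩
    mulPS onePS (mulPS onePS (θ f))
      ≋.≈⟨ mulPS-congʳ (mulPS onePS (θ f)) (PS.sym (PS.trans (constPS-cong nat-1) constPS-1)) ⟩
    mulPS (constPS (nat 1)) (mulPS onePS (θ f)) ≋.∎
  θ-powPS f (suc m) = ≋.begin
    θ (mulPS f fᵐ⁺¹)                            ≋.≈⟨ θ-leibniz f fᵐ⁺¹ ⟩
    mulPS (θ f) fᵐ⁺¹ +ₚ mulPS f (θ fᵐ⁺¹)
      ≋.≈⟨ +ₚ-congˡ (mulPS (θ f) fᵐ⁺¹) (mulPS-congˡ f (θ-powPS f m)) ⟩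
    mulPS (θ f) fᵐ⁺¹ +ₚ mulPS f (mulPS N (mulPS (powPS f m) (θ f)))
      ≋.≈⟨ solveₚ 4 (λ θf f N fᵐ → θf ⊗ (f ⊗ fᵐ) ⊕ f ⊗ (N ⊗ (fᵐ ⊗ θf)) ≐ (conₚ (+ 1) ⊕ N) ⊗ ((f ⊗ fᵐ) ⊗ θf))
             PS.refl (θ f) f N (powPS f m) ⟩
    mulPS (onePS +ₚ N) (mulPS fᵐ⁺¹ (θ f))
      ≋.≈⟨ mulPS-congʳ (mulPS fᵐ⁺¹ (θ f)) (PS.sym (constPS-nat-suc (suc m))) ⟩
    mulPS (constPS (nat (suc (suc m)))) (mulPS fᵐ⁺¹ (θ f)) ≋.∎
    where
    fᵐ⁺¹ = powPS f (suc m)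
    N = constPS (nat (suc m))

  E₁-θ-powPS-uPS : ∀ m → mulPS E₁ (θ (powPS uPS m)) ≋ mulPS (constPS (nat m)) (powPS uPS m)
  E₁-θ-powPS-uPS zero n = begin
    mulPS E₁ (θ onePS) n             ≈⟨ mulPS-congˡ E₁ θ-onePS n ⟩
    mulPS E₁ 0ₚ n                    ≈⟨ sumTo-zero (suc n) _ (λ i _ → zeroʳ _) ⟩
    0#                               ≈⟨ sym (trans (mulPS-constPS 0# onePS n) (zeroˡ _)) ⟩
    mulPS (constPS 0#) onePS n       ∎
  E₁-θ-powPS-uPS (suc m) = ≋.begin
    mulPS E₁ (θ (powPS uPS (suc m)))           ≋.≈⟨ mulPS-congˡ E₁ (θ-powPS uPS m) ⟩
    mulPS E₁ (mulPS N (mulPS uᵐ (θ uPS)))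
      ≋.≈⟨ solveₚ 4 (λ E N uᵐ θu → E ⊗ (N ⊗ (uᵐ ⊗ θu)) ≐ N ⊗ (uᵐ ⊗ (θu ⊗ E))) PS.refl E₁ N uᵐ (θ uPS) ⟩
    mulPS N (mulPS uᵐ (mulPS (θ uPS) E₁))      ≋.≈⟨ mulPS-congˡ N (mulPS-congˡ uᵐ θ-uPS-E₁) ⟩
    mulPS N (mulPS uᵐ uPS)                     ≋.≈⟨ mulPS-congˡ N (mulPS-comm uᵐ uPS) ⟩
    mulPS N (powPS uPS (suc m))                ≋.∎
    where
    uᵐ = powPS uPS m
    N = constPS (nat (suc m))

  powPS-uPS-vanishes : ∀ m n → n < m → powPS uPS m n ≈ 0#
  powPS-uPS-vanishes (suc m) n (s≤s n≤m) = sumTo-zero (suc n) _ term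
    where
    term : ∀ i → i < suc n → uPS i * powPS uPS m (n ∸ i) ≈ 0#
    term zero _ = zeroˡ _
    term (suc i) (s≤s i<n) = trans (*-congˡ (powPS-uPS-vanishes m (n ∸ suc i)
      (ℕ.<-≤-trans (ℕ.∸-monoʳ-< {n} {suc i} {0} (s≤s z≤n) i<n) n≤m))) (zeroʳ _)

  -- Σₘ a m · P m; when P m = O(tᵐ) only the terms m ≤ n contribute to the coefficient of tⁿ.
  familySum : (ℕ → Carrier) → (ℕ → PS) → PS
  familySum a P n = sumTo (suc n) (λ m → a m * P m n)

  mulPS-familySum : ∀ g a (P : ℕ → PS) → (∀ m j → j < m → P m j ≈ 0#) →
    mulPS g (familySum a P) ≋ familySum a (λ m → mulPS g (P m))
  mulPS-familySum g a P P-order n = begin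
    sumTo (suc n) (λ i → g i * sumTo (suc (n ∸ i)) (λ m → a m * P m (n ∸ i)))
      ≈⟨ sumTo-cong< (suc n) (λ i _ → *-congˡ (sym (sumTo-extend (suc (n ∸ i)) (suc n) _ (s≤s (ℕ.m∸n≤m n i))
           (λ m n-i<m _ → trans (*-congˡ (P-order m (n ∸ i) n-i<m)) (zeroʳ _))))) ⟩
    sumTo (suc n) (λ i → g i * sumTo (suc n) (λ m → a m * P m (n ∸ i)))
      ≈⟨ sumTo-cong (suc n) (λ i → sumTo-*ˡ (suc n) (g i) _) ⟩
    sumTo (suc n) (λ i → sumTo (suc n) (λ m → g i * (a m * P m (n ∸ i))))
      ≈⟨ sumTo-swap (suc n) (suc n) _ ⟩
    sumTo (suc n) (λ m → sumTo (suc n) (λ i → g i * (a m * P m (n ∸ i))))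
      ≈⟨ sumTo-cong (suc n) (λ m → trans
           (sumTo-cong (suc n) (λ i → x*[y*z]≈y*[x*z] (g i) (a m) (P m (n ∸ i))))
           (sym (sumTo-*ˡ (suc n) (a m) _))) ⟩
    sumTo (suc n) (λ m → a m * mulPS g (P m) n)
      ∎
    where
    x*[y*z]≈y*[x*z] : ∀ x y z → x * (y * z) ≈ y * (x * z)
    x*[y*z]≈y*[x*z] = solve 3 (λ x y z → x :* (y :* z) := y :* (x :* z)) refl

  θ-familySum : ∀ a P → θ (familySum a P) ≋ familySum a (λ m → θ (P m))
  θ-familySum a P n = trans (sumTo-*ˡ (suc n) (nat n) _) (sumTo-cong (suc n) (λ m →
    solve 3 (λ x y z → x :* (y :* z) := y :* (x :* z)) refl (nat n) (a m) (P m n)))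

  familySum-sub : ∀ a b P → familySum a P +ₚ -ₚ familySum b P ≋ familySum (λ m → a m - b m) P
  familySum-sub a b P n = begin
    familySum a P n + - familySum b P n
      ≈⟨ +-congˡ (sumTo-neg (suc n) _) ⟩
    familySum a P n + sumTo (suc n) (λ m → - (b m * P m n))
      ≈⟨ sym (sumTo-+ (suc n) _ _) ⟩
    sumTo (suc n) (λ m → a m * P m n + - (b m * P m n))
      ≈⟨ sumTo-cong (suc n) (λ m → solve 3 (λ x y p → x :* p :+ :- (y :* p) := (x :+ :- y) :* p)
           refl (a m) (b m) (P m n)) ⟩
    familySum (λ m → a m - b m) P n
      ∎

  E₁-θ-familySum-uPS : ∀ a →
    mulPS E₁ (θ (familySum a (powPS uPS))) ≋ familySum (λ m → nat m * a m) (powPS uPS)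
  E₁-θ-familySum-uPS a n = begin
    mulPS E₁ (θ (familySum a (powPS uPS))) n
      ≈⟨ mulPS-congˡ E₁ (θ-familySum a (powPS uPS)) n ⟩
    mulPS E₁ (familySum a (λ m → θ (powPS uPS m))) n
      ≈⟨ mulPS-familySum E₁ a (λ m → θ (powPS uPS m))
           (λ m j j<m → trans (*-congˡ (powPS-uPS-vanishes m j j<m)) (zeroʳ _)) n ⟩
    sumTo (suc n) (λ m → a m * mulPS E₁ (θ (powPS uPS m)) n)
      ≈⟨ sumTo-cong (suc n) (λ m → trans
           (*-congˡ (trans (E₁-θ-powPS-uPS m n) (mulPS-constPS (nat m) (powPS uPS m) n)))
           (trans (sym (*-assoc _ _ _)) (*-congʳ (*-comm _ _)))) ⟩
    familySum (λ m → nat m * a m) (powPS uPS) n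
      ∎

  invPowℤ-pred : ∀ m k → invPowℤ (suc m) (k -ℤ 1ℤ) ≈ nat (suc m) * invPowℤ (suc m) k
  invPowℤ-pred m (+ zero) = refl
  invPowℤ-pred m (+ suc n) = begin
    invN (suc m) ^ n                                 ≈⟨ sym (*-identityˡ _) ⟩
    1# * invN (suc m) ^ n                            ≈⟨ *-congʳ (sym (nat*invN m)) ⟩
    (nat (suc m) * invN (suc m)) * invN (suc m) ^ n  ≈⟨ *-assoc _ _ _ ⟩
    nat (suc m) * (invN (suc m) * invN (suc m) ^ n)  ∎
  invPowℤ-pred m -[1+ n ] = reflexive (≡.cong (λ j → nat (suc m) ^ suc (suc j)) (ℕ.+-identityʳ n))

  θ-LiDivPS : ∀ k → θ (LiDivPS k) ≋ mulPS T₁ (LiDivPS (k -ℤ 1ℤ) +ₚ -ₚ LiDivPS k)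
  θ-LiDivPS k = ≋.begin
    θ L                        ≋.≈⟨ PS.sym (mulPS-identityˡ (θ L)) ⟩
    mulPS onePS (θ L)          ≋.≈⟨ mulPS-congʳ (θ L) (PS.trans (PS.sym E₁-T₁) (mulPS-comm E₁ T₁)) ⟩
    mulPS (mulPS T₁ E₁) (θ L)  ≋.≈⟨ mulPS-assoc T₁ E₁ (θ L) ⟩
    mulPS T₁ (mulPS E₁ (θ L))  ≋.≈⟨ mulPS-congˡ T₁ (PS.trans (E₁-θ-familySum-uPS a) weights) ⟩
    mulPS T₁ (L′ +ₚ -ₚ L)      ≋.∎
    where
    a a′ : ℕ → Carrier
    a m = invPowℤ (suc m) k
    a′ m = invPowℤ (suc m) (k -ℤ 1ℤ)
    L = LiDivPS k
    L′ = LiDivPS (k -ℤ 1ℤ)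
    weights : familySum (λ m → nat m * a m) (powPS uPS) ≋ L′ +ₚ -ₚ L
    weights = PS.trans (λ n → sumTo-cong (suc n) (λ m → *-congʳ (sym (trans (+-congʳ (invPowℤ-pred m k))
      (solve 2 (λ N x → (con (+ 1) :+ N) :* x :+ :- x := N :* x) refl (nat m) (a m))))))
      (PS.sym (familySum-sub a′ a (powPS uPS)))

  -- The generating function of S

  prodT : ∀ {r} → Vec Carrier r → PS
  prodT as = prodPS (Vec.map tOverExpm1 as)

  logDerivative : ∀ {r} → Vec Carrier r → PS
  logDerivative [] = 0ₚ
  logDerivative (a ∷ as) = (onePS +ₚ -ₚ scale (- a) T₁) +ₚ logDerivative as

  θ-prodT : ∀ {r} (as : Vec Carrier r) → All (λ a → ¬ (a ≈ 0#)) as →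
    θ (prodT as) ≋ mulPS (prodT as) (logDerivative as)
  θ-prodT [] [] = PS.trans θ-onePS (solveₚ 0 (conₚ (+ 0) ≐ conₚ (+ 1) ⊗ conₚ (+ 0)) PS.refl)
  θ-prodT (a ∷ as) (a≉0 ∷ as≉0) = ≋.begin
    θ (mulPS T P)                                           ≋.≈⟨ θ-leibniz T P ⟩
    mulPS (θ T) P +ₚ mulPS T (θ P)
      ≋.≈⟨ PS.+-cong (mulPS-congʳ P (θ-tOverExpm1 a a≉0)) (mulPS-congˡ T (θ-prodT as as≉0)) ⟩
    mulPS (mulPS T (onePS +ₚ -ₚ H)) P +ₚ mulPS T (mulPS P (logDerivative as))
      ≋.≈⟨ solveₚ 4 (λ T H P β → (T ⊗ (conₚ (+ 1) ⊕ ⊝ H)) ⊗ P ⊕ T ⊗ (P ⊗ β)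
                                  ≐ (T ⊗ P) ⊗ ((conₚ (+ 1) ⊕ ⊝ H) ⊕ β))
             PS.refl T H P (logDerivative as) ⟩
    mulPS (mulPS T P) (logDerivative (a ∷ as))              ≋.∎
    where
    T = tOverExpm1 a
    H = scale (- a) T₁
    P = prodT as

  prodT-snoc : ∀ {r} (as : Vec Carrier r) → prodT (as ∷ʳ 1#) ≋ mulPS (prodT as) T₁
  prodT-snoc [] = mulPS-comm T₁ onePS
  prodT-snoc (a ∷ as) =
    PS.trans (mulPS-congˡ (tOverExpm1 a) (prodT-snoc as)) (PS.sym (mulPS-assoc (tOverExpm1 a) (prodT as) T₁))

  neg-^ : ∀ a i → (- a) ^ i ≈ ((- 1#) ^ i) * a ^ i
  neg-^ a i = trans (^-cong i (sym (-1*x≈-x a))) (^-distrib-* (- 1#) a i)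

  T₁-zero : T₁ 0 ≈ 1#
  T₁-zero = trans (inv-cong (expm1DivT-zero 1#)) inv-1

  logDerivative-zero : ∀ {r} (as : Vec Carrier r) → logDerivative as 0 ≈ 0#
  logDerivative-zero [] = refl
  logDerivative-zero (a ∷ as) = trans
    (+-cong (trans (+-congˡ (-‿cong (trans (*-identityˡ _) T₁-zero))) (-‿inverseʳ 1#))
            (logDerivative-zero as))
    (+-identityˡ 0#)

  logDerivative-suc : ∀ {r} (as : Vec Carrier r) i →
    logDerivative as (suc i) ≈ (((- 1#) ^ i) * T₁ (suc i)) * sumVec (Vec.map (λ a → a ^ suc i) as)
  logDerivative-suc [] i = sym (zeroʳ _)
  logDerivative-suc (a ∷ as) i = begin
    (0# + - (((- a) * (- a) ^ i) * T₁ (suc i))) + logDerivative as (suc i)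
      ≈⟨ +-cong (+-congˡ (-‿cong (*-congʳ (*-congˡ (neg-^ a i))))) (logDerivative-suc as i) ⟩
    (0# + - (((- a) * (((- 1#) ^ i) * a ^ i)) * T₁ (suc i))) + (((- 1#) ^ i) * T₁ (suc i)) * V
      ≈⟨ solve 5 (λ a s p t V → (con (+ 0) :+ :- (((:- a) :* (s :* p)) :* t)) :+ (s :* t) :* V
                                  := (s :* t) :* (a :* p :+ V))
           refl a ((- 1#) ^ i) (a ^ i) (T₁ (suc i)) V ⟩
    (((- 1#) ^ i) * T₁ (suc i)) * sumVec (Vec.map (λ a → a ^ suc i) (a ∷ as))
      ∎
    where
    V = sumVec (Vec.map (λ a → a ^ suc i) as)

  θ-genS : ∀ {r} k (as : Vec Carrier r) → All (λ a → ¬ (a ≈ 0#)) as → ∀ x →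
    θ (genS k as x) ≋ mulPS (constPS x) (mulPS tPS (genS k as x)) +ₚ mulPS (logDerivative as) (genS k as x)
                      +ₚ genS (k -ℤ 1ℤ) (as ∷ʳ 1#) x +ₚ -ₚ genS k (as ∷ʳ 1#) x
  θ-genS k as as≉0 x = ≋.begin
    θ (mulPS (mulPS P L) e)
      ≋.≈⟨ θ-leibniz (mulPS P L) e ⟩
    mulPS (θ (mulPS P L)) e +ₚ mulPS (mulPS P L) (θ e)
      ≋.≈⟨ PS.+-cong (mulPS-congʳ e (PS.trans (θ-leibniz P L)
             (PS.+-cong (mulPS-congʳ L (θ-prodT as as≉0)) (mulPS-congˡ P (θ-LiDivPS k)))))
           (mulPS-congˡ (mulPS P L) (θ-expPS x)) ⟩
    mulPS (mulPS (mulPS P β) L +ₚ mulPS P (mulPS T₁ (L′ +ₚ -ₚ L))) e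
      +ₚ mulPS (mulPS P L) (mulPS X (mulPS tPS e))
      ≋.≈⟨ solveₚ 8 (λ P β L L′ T e X t →
             ((P ⊗ β) ⊗ L ⊕ P ⊗ (T ⊗ (L′ ⊕ ⊝ L))) ⊗ e ⊕ (P ⊗ L) ⊗ (X ⊗ (t ⊗ e))
             ≐ X ⊗ (t ⊗ ((P ⊗ L) ⊗ e)) ⊕ β ⊗ ((P ⊗ L) ⊗ e) ⊕ ((P ⊗ T) ⊗ L′) ⊗ e ⊕ ⊝ (((P ⊗ T) ⊗ L) ⊗ e))
           PS.refl P β L L′ T₁ e X tPS ⟩
    mulPS X (mulPS tPS G) +ₚ mulPS β G +ₚ mulPS (mulPS (mulPS P T₁) L′) e +ₚ -ₚ mulPS (mulPS (mulPS P T₁) L) e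
      ≋.≈⟨ PS.+-cong (+ₚ-congˡ (mulPS X (mulPS tPS G) +ₚ mulPS β G) (snoc L′))
             (-ₚ-cong (snoc L)) ⟩
    mulPS X (mulPS tPS G) +ₚ mulPS β G +ₚ genS (k -ℤ 1ℤ) (as ∷ʳ 1#) x +ₚ -ₚ genS k (as ∷ʳ 1#) x
      ≋.∎
    where
    P = prodT as
    β = logDerivative as
    L = LiDivPS k
    L′ = LiDivPS (k -ℤ 1ℤ)
    e = expPS x
    X = constPS x
    G = genS k as x
    snoc : ∀ M → mulPS (mulPS (mulPS P T₁) M) e ≋ mulPS (mulPS (prodT (as ∷ʳ 1#)) M) e
    snoc M = mulPS-congʳ e (mulPS-congʳ M (PS.sym (prodT-snoc as)))

  genS-recurrence : ∀ {r} k (as : Vec Carrier r) → All (λ a → ¬ (a ≈ 0#)) as → ∀ x m →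
    let G = genS k as x in
    nat (suc m) * G (suc m) ≈
      x * G m + sumTo (suc m) (λ i → logDerivative as (suc i) * G (m ∸ i))
      + genS (k -ℤ 1ℤ) (as ∷ʳ 1#) x (suc m) + - genS k (as ∷ʳ 1#) x (suc m)
  genS-recurrence k as as≉0 x m = trans (θ-genS k as as≉0 x (suc m))
    (+-congʳ (+-congʳ (+-cong
      (trans (mulPS-constPS x (mulPS tPS G) (suc m)) (*-congˡ (mulPS-tPS-suc G m)))
      (trans (sumTo-head (suc m) _)
        (trans (+-congʳ (trans (*-congʳ (logDerivative-zero as)) (zeroˡ _))) (+-identityˡ _))))))
    where
    G = genS k as x

  nat-! : ∀ m i → i ≤ m → nat (m !) ≈ ((nat (m C i) * nat (suc i !)) * invN (suc i)) * nat ((m ∸ i) !)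
  nat-! m i i≤m = sym (begin
    ((nat (m C i) * nat (suc i !)) * invN (suc i)) * nat ((m ∸ i) !)
      ≈⟨ *-congʳ (trans (*-assoc _ _ _) (*-congˡ (trans (*-comm _ _) (invN*nat! i)))) ⟩
    (nat (m C i) * nat (i !)) * nat ((m ∸ i) !)
      ≈⟨ *-assoc _ _ _ ⟩
    nat (m C i) * (nat (i !) * nat ((m ∸ i) !))
      ≈⟨ sym (trans (nat-homo-* (m C i) _) (*-congˡ (nat-homo-* (i !) ((m ∸ i) !)))) ⟩
    nat ((m C i) ℕ.* (i ! ℕ.* (m ∸ i) !))
      ≡⟨ ≡.cong nat (nCk*k!*[n∸k]!≡n! i≤m) ⟩
    nat (m !)
      ∎)

  nat-!-logDerivative : ∀ {r} (as : Vec Carrier r) m i y → i ≤ m →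
    nat (m !) * (logDerivative as (suc i) * y) ≈
      ((- 1#) ^ i) * nat (m C i) * B (suc i) * invN (suc i)
      * sumVec (Vec.map (λ a → a ^ suc i) as) * (nat ((m ∸ i) !) * y)
  nat-!-logDerivative as m i y i≤m = begin
    nat (m !) * (logDerivative as (suc i) * y)
      ≈⟨ *-cong (nat-! m i i≤m) (*-congʳ (logDerivative-suc as i)) ⟩
    (((nat (m C i) * nat (suc i !)) * invN (suc i)) * nat ((m ∸ i) !)) * (((s * T₁ (suc i)) * V) * y)
      ≈⟨ solve 8 (λ c f v d s t V y → (((c :* f) :* v) :* d) :* (((s :* t) :* V) :* y)
                                       := ((((s :* c) :* (f :* t)) :* v) :* V) :* (d :* y))
           refl (nat (m C i)) (nat (suc i !)) (invN (suc i)) (nat ((m ∸ i) !)) s (T₁ (suc i)) V y ⟩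
    s * nat (m C i) * B (suc i) * invN (suc i) * V * (nat ((m ∸ i) !) * y)
      ∎
    where
    s = (- 1#) ^ i
    V = sumVec (Vec.map (λ a → a ^ suc i) as)

theorem4 : ∀ {c ℓ} (F : CharZeroField c ℓ) →
  let open CharZeroField F
      open WithField F
  in (r : ℕ) → 1 ≤ r → (k : ℤ) → (as : Vec Carrier r) →
     All (λ a → ¬ (a ≈ 0#)) as → (x : Carrier) → (n : ℕ) → 1 ≤ n →
     S k as x n ≈
       x * S k as x (n ∸ 1)
       + sumTo n (λ i →
           ((- 1#) ^ i) * nat ((n ∸ 1) C i) * B (suc i) * invN (suc i)
           * sumVec (Vec.map (λ a → a ^ suc i) as) * S k as x (n ∸ suc i))
       + invN n * S (k -ℤ 1ℤ) (as ∷ʳ 1#) x n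
       + - (invN n * S k (as ∷ʳ 1#) x n)
-- The recurrence holds for r = 0 as well.
theorem4 F _ _ k as as≉0 x (suc m) _ = begin
  nat (suc m !) * G (suc m)                 ≈⟨ *-congʳ (trans (nat-homo-* (suc m) (m !)) (*-comm _ _)) ⟩
  (m! * nat (suc m)) * G (suc m)            ≈⟨ *-assoc _ _ _ ⟩
  m! * (nat (suc m) * G (suc m))            ≈⟨ *-congˡ (genS-recurrence k as as≉0 x m) ⟩
  m! * (x * G m + Σβ + G′ (suc m) + - G″ (suc m))
    ≈⟨ solve 6 (λ K x g s g′ g″ → K :* (x :* g :+ s :+ g′ :+ :- g″)
                                 := x :* (K :* g) :+ K :* s :+ K :* g′ :+ :- (K :* g″))
         refl m! x (G m) Σβ (G′ (suc m)) (G″ (suc m)) ⟩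
  x * (m! * G m) + m! * Σβ + m! * G′ (suc m) + - (m! * G″ (suc m))
    ≈⟨ +-cong (+-cong (+-congˡ (trans (sumTo-*ˡ (suc m) m! _) (sumTo-cong< (suc m) (λ i i≤m →
         nat-!-logDerivative as m i (G (m ∸ i)) (ℕ.≤-pred i≤m)))))
         (sym (invN*nat!* G′))) (-‿cong (sym (invN*nat!* G″))) ⟩
  x * S k as x m + sumTo (suc m) (λ i → ((- 1#) ^ i) * nat (m C i) * B (suc i) * invN (suc i)
                                        * sumVec (Vec.map (λ a → a ^ suc i) as) * S k as x (m ∸ i))
    + invN (suc m) * S (k -ℤ 1ℤ) (as ∷ʳ 1#) x (suc m) + - (invN (suc m) * S k (as ∷ʳ 1#) x (suc m))
    ∎
  where
  open CharZeroField F
  open WithField F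
  open Recurrence F
  open NatEmbedding commutativeRing renaming (natF-homo-* to nat-homo-*)
  open IntegerRingSolver commutativeRing using (solve; _:+_; _:*_; :-_; _:=_)
  open SetoidReasoning setoid
  m! = nat (m !)
  G = genS k as x
  G′ = genS (k -ℤ 1ℤ) (as ∷ʳ 1#) x
  G″ = genS k (as ∷ʳ 1#) x
  Σβ = sumTo (suc m) (λ i → logDerivative as (suc i) * G (m ∸ i))
  invN*nat!* : ∀ H → invN (suc m) * (nat (suc m !) * H (suc m)) ≈ m! * H (suc m)
  invN*nat!* H = trans (sym (*-assoc _ _ _)) (*-congʳ (invN*nat! m))
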